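{- Let $m$ be a positive integer. Then, for $0\le i,j\le m$: (1) the change of basis matrix from $\mathbf{H}^{\bullet}_m$ to $\mathbf{F}^{\blacktriangledown}_m$ has $(i,j)$th entry $2^{i+j-m}\binom{i}{m-j}$; (2) the change of basis matrix from $\mathbf{F}^{\blacktriangledown}_m$ to $\mathbf{H}^{\bullet}_m$ has $(i,j)$th entry $(-2)^{m-j-i}\binom{m-i}{j}$.
   Context: All vectors are row vectors in $\mathbb{R}^{m+1}$ with components indexed $0,\dots,m$; matrices have rows and columns indexed from $0$. Binomial coefficients $\binom{a}{b}$ with $a\ge0$ are $0$ when $b<0$ or $b>a$ (so entries involving a negative power of $2$ are $0$). Bases of $\mathbb{R}^{m+1}$, each consisting of vectors indexed by $i=0,\dots,m$, with $j$th component given: $\mathbf{H}^{\bullet}_m$: $\vartheta^{\bullet}(i;m)_j=(-1)^{j-i}\binom{m-i}{j-i}$; $\mathbf{F}^{\blacktriangledown}_m$: $\varphi^{\blacktriangledown}(i;m)_j=\binom{i}{m-j}$. The change of basis matrix from a basis $\mathfrak{B}=(b_0,\dots,b_m)$ to a basis $\mathfrak{B}'=(b'_0,\dots,b'_m)$ is the matrix whose $i$th row is the coordinate vector of $b'_i$ with respect to $\mathfrak{B}$, i.e. the unique $(\kappa_0,\dots,\kappa_m)$ with $\sum_k\kappa_kb_k=b'_i$. -}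

module Defs where

open import Data.Nat as ℕ using (ℕ; zero; suc; _∸_; _≤ᵇ_)
open import Data.Nat.Combinatorics using (_C_)
open import Data.Integer as ℤ using (ℤ; +_; -_; _+_; _*_; _^_)
open import Data.Fin using (Fin; toℕ; zero; suc)
open import Data.Bool using (if_then_else_)
open import Relation.Binary.PropositionalEquality using (_≡_)

Σ : (n : ℕ) → (Fin n → ℤ) → ℤ
Σ zero    f = + 0
Σ (suc n) f = f zero + Σ n (λ k → f (suc k))

-- ϑ•(i;m)_j = (-1)^(j-i) * binom(m-i, j-i), which is 0 when j < i
vartheta : (m : ℕ) → Fin (suc m) → Fin (suc m) → ℤ
vartheta m i j =
  if toℕ i ≤ᵇ toℕ j
  then ((- + 1) ^ (toℕ j ∸ toℕ i)) * + ((m ∸ toℕ i) C (toℕ j ∸ toℕ i))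
  else + 0

-- φ▼(i;m)_j = binom(i, m-j)   (m - j ≥ 0 since j ≤ m)
varphi : (m : ℕ) → Fin (suc m) → Fin (suc m) → ℤ
varphi m i j = + (toℕ i C (m ∸ toℕ j))

-- claimed entries of the change of basis matrix from H• to F▼:
-- 2^(i+j-m) * binom(i, m-j); 0 when i+j-m < 0 (negative power of 2)
entryHF : (m : ℕ) → Fin (suc m) → Fin (suc m) → ℤ
entryHF m i j =
  if m ≤ᵇ (toℕ i ℕ.+ toℕ j)
  then ((+ 2) ^ ((toℕ i ℕ.+ toℕ j) ∸ m)) * + (toℕ i C (m ∸ toℕ j))
  else + 0

-- claimed entries of the change of basis matrix from F▼ to H•:
-- (-2)^(m-j-i) * binom(m-i, j); 0 when m-j-i < 0
entryFH : (m : ℕ) → Fin (suc m) → Fin (suc m) → ℤ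
entryFH m i j =
  if (toℕ i ℕ.+ toℕ j) ≤ᵇ m
  then ((- + 2) ^ (m ∸ (toℕ i ℕ.+ toℕ j))) * + ((m ∸ toℕ i) C toℕ j)
  else + 0

lincomb : (m : ℕ) → (Fin (suc m) → ℤ) → (Fin (suc m) → Fin (suc m) → ℤ)
        → Fin (suc m) → ℤ
lincomb m κ b j = Σ (suc m) (λ k → κ k * b k j)

-- C is the change of basis matrix from basis b to basis b':
-- row i of C is the coordinate vector of b'_i with respect to b.
-- (Coordinates are unique since b is a basis.)
IsChangeOfBasis : (m : ℕ) → (b b' C : Fin (suc m) → Fin (suc m) → ℤ) → Set
IsChangeOfBasis m b b' C = ∀ i j → lincomb m (C i) b j ≡ b' i j

module Submission where

-- Write P(z) for the matrix with entries P(z)ₙₖ = C(n,k) zⁿ⁻ᵏ.  These generalised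
-- Pascal matrices satisfy P(x) P(y) = P(x + y), by induction on the row using
-- Pascal's rule in both factors.  After reflecting an index k ↦ m − k all the
-- matrices in question are Pascal matrices:  the (i, m − l) entry of the H•→F▼
-- matrix is P(2)ᵢₗ, the (i, k) entry of the F▼→H• matrix is P(−2)₍ₘ₋ᵢ₎ₖ,
-- ϑ•(i;m)ⱼ = P(−1)₍ₘ₋ᵢ₎₍ₘ₋ⱼ₎ and φ▼(i;m)ⱼ = P(1)ᵢ₍ₘ₋ⱼ₎.  So the two claims are
-- P(2) P(−1) = P(1) and P(−2) P(1) = P(−1).

open import Defs
open import Data.Bool using (true; false; if_then_else_)
open import Data.Fin using (Fin; toℕ)
open import Data.Fin.Properties using (toℕ≤pred[n])
open import Data.Integer using (ℤ; +_; -_; _+_; _*_; _^_)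
open import Data.Integer.Properties
  using (+-assoc; +-comm; *-identityˡ; *-zeroʳ; *-assoc; *-distribˡ-+; *-distribʳ-+; ^-zeroˡ)
open import Data.Integer.Tactic.RingSolver using (solve-∀)
open import Data.Nat as ℕ using (ℕ; NonZero; zero; suc; _∸_; _≤ᵇ_; _≤_; _<_; s≤s; _<?_)
import Data.Nat.Properties as ℕ
open import Data.Nat.Combinatorics using (_C_; k>n⇒nCk≡0; nCk≡nC[n∸k]; nCk+nC[k+1]≡[n+1]C[k+1])
open import Data.Product using (_×_; _,_)
open import Relation.Nullary using (yes; no)
open import Relation.Nullary.Reflects using (ofʸ; ofⁿ)
open import Relation.Binary.PropositionalEquality
open ≡-Reasoning

m+n∸o≡m∸[o∸n] : ∀ m {n o} → n ≤ o → m ℕ.+ n ∸ o ≡ m ∸ (o ∸ n)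
m+n∸o≡m∸[o∸n] m {n} {o} n≤o = begin
  m ℕ.+ n ∸ o                 ≡⟨ cong (m ℕ.+ n ∸_) (sym (ℕ.m∸n+n≡m n≤o)) ⟩
  m ℕ.+ n ∸ (o ∸ n ℕ.+ n)     ≡⟨ cong₂ _∸_ (ℕ.+-comm m n) (ℕ.+-comm (o ∸ n) n) ⟩
  n ℕ.+ m ∸ (n ℕ.+ (o ∸ n))   ≡⟨ ℕ.[m+n]∸[m+o]≡n∸o n m (o ∸ n) ⟩
  m ∸ (o ∸ n)                 ∎

[m∸n]∸[m∸o]≡o∸n : ∀ m n {o} → o ≤ m → (m ∸ n) ∸ (m ∸ o) ≡ o ∸ n
[m∸n]∸[m∸o]≡o∸n m n {o} o≤m = begin
  (m ∸ n) ∸ (m ∸ o)   ≡⟨ ℕ.∸-+-assoc m n (m ∸ o) ⟩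
  m ∸ (n ℕ.+ (m ∸ o)) ≡⟨ cong (m ∸_) (ℕ.+-comm n (m ∸ o)) ⟩
  m ∸ (m ∸ o ℕ.+ n)   ≡⟨ sym (ℕ.∸-+-assoc m (m ∸ o) n) ⟩
  (m ∸ (m ∸ o)) ∸ n   ≡⟨ cong (_∸ n) (ℕ.m∸[m∸n]≡n o≤m) ⟩
  o ∸ n               ∎

if-≤ᵇ-then-else-0 : ∀ p q {v w : ℤ} →
  (p ≤ q → v ≡ w) → (q < p → w ≡ + 0) → (if p ≤ᵇ q then v else + 0) ≡ w
if-≤ᵇ-then-else-0 p q ≤-case >-case with p ≤ᵇ q | ℕ.≤ᵇ-reflects-≤ p q
... | true  | ofʸ p≤q = ≤-case p≤q
... | false | ofⁿ p≰q = sym (>-case (ℕ.≰⇒> p≰q))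

Σ-cong : ∀ n {f g : Fin n → ℤ} → (∀ k → f k ≡ g k) → Σ n f ≡ Σ n g
Σ-cong zero    f≗g = refl
Σ-cong (suc n) f≗g = cong₂ _+_ (f≗g Fin.zero) (Σ-cong n (λ k → f≗g (Fin.suc k)))

sumTo : ℕ → (ℕ → ℤ) → ℤ
sumTo n f = Σ n (λ k → f (toℕ k))

sumTo-cong : ∀ n {f g : ℕ → ℤ} → (∀ l → f l ≡ g l) → sumTo n f ≡ sumTo n g
sumTo-cong n f≗g = Σ-cong n (λ k → f≗g (toℕ k))

sumTo-0 : ∀ n → sumTo n (λ _ → + 0) ≡ + 0
sumTo-0 zero    = refl
sumTo-0 (suc n) = cong (_+_ (+ 0)) (sumTo-0 n)

sumTo-distrib-+ : ∀ n (f g : ℕ → ℤ) → sumTo n (λ l → f l + g l) ≡ sumTo n f + sumTo n g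
sumTo-distrib-+ zero    f g = refl
sumTo-distrib-+ (suc n) f g = begin
  (f 0 + g 0) + sumTo n (λ l → f (suc l) + g (suc l))
    ≡⟨ cong (_+_ (f 0 + g 0)) (sumTo-distrib-+ n (λ l → f (suc l)) (λ l → g (suc l))) ⟩
  (f 0 + g 0) + (sumTo n (λ l → f (suc l)) + sumTo n (λ l → g (suc l)))
    ≡⟨ medial (f 0) (g 0) _ _ ⟩
  (f 0 + sumTo n (λ l → f (suc l))) + (g 0 + sumTo n (λ l → g (suc l))) ∎
  where
  medial : ∀ a b c d → (a + b) + (c + d) ≡ (a + c) + (b + d)
  medial = solve-∀

*-distribˡ-sumTo : ∀ n c (f : ℕ → ℤ) → c * sumTo n f ≡ sumTo n (λ l → c * f l)
*-distribˡ-sumTo zero    c f = *-zeroʳ c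
*-distribˡ-sumTo (suc n) c f = begin
  c * (f 0 + sumTo n (λ l → f (suc l)))
    ≡⟨ *-distribˡ-+ c (f 0) _ ⟩
  c * f 0 + c * sumTo n (λ l → f (suc l))
    ≡⟨ cong (_+_ (c * f 0)) (*-distribˡ-sumTo n c (λ l → f (suc l))) ⟩
  c * f 0 + sumTo n (λ l → c * f (suc l)) ∎

sumTo-snoc : ∀ n (f : ℕ → ℤ) → sumTo (suc n) f ≡ sumTo n f + f n
sumTo-snoc zero    f = +-comm (f 0) (+ 0)
sumTo-snoc (suc n) f = begin
  f 0 + sumTo (suc n) (λ l → f (suc l))
    ≡⟨ cong (_+_ (f 0)) (sumTo-snoc n (λ l → f (suc l))) ⟩
  f 0 + (sumTo n (λ l → f (suc l)) + f (suc n))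
    ≡⟨ sym (+-assoc (f 0) _ (f (suc n))) ⟩
  f 0 + sumTo n (λ l → f (suc l)) + f (suc n) ∎

sumTo-reverse : ∀ n (f : ℕ → ℤ) → sumTo (suc n) (λ k → f (n ∸ k)) ≡ sumTo (suc n) f
sumTo-reverse zero    f = refl
sumTo-reverse (suc n) f = begin
  f (suc n) + sumTo (suc n) (λ k → f (n ∸ k))
    ≡⟨ cong (_+_ (f (suc n))) (sumTo-reverse n f) ⟩
  f (suc n) + sumTo (suc n) f
    ≡⟨ +-comm (f (suc n)) _ ⟩
  sumTo (suc n) f + f (suc n)
    ≡⟨ sym (sumTo-snoc (suc n) f) ⟩
  sumTo (suc (suc n)) f ∎

-- The truncated exponent is harmless: n C k = 0 whenever n ∸ k is truncated.
pascal : ℤ → ℕ → ℕ → ℤ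
pascal z n k = z ^ (n ∸ k) * + (n C k)

k>n⇒pascal≡0 : ∀ z {n k} → n < k → pascal z n k ≡ + 0
k>n⇒pascal≡0 z {n} {k} n<k = begin
  z ^ (n ∸ k) * + (n C k) ≡⟨ cong (λ c → z ^ (n ∸ k) * + c) (k>n⇒nCk≡0 n<k) ⟩
  z ^ (n ∸ k) * + 0       ≡⟨ *-zeroʳ (z ^ (n ∸ k)) ⟩
  + 0                     ∎

pascal-1 : ∀ n k → pascal (+ 1) n k ≡ + (n C k)
pascal-1 n k = begin
  (+ 1) ^ (n ∸ k) * + (n C k) ≡⟨ cong (_* + (n C k)) (^-zeroˡ (n ∸ k)) ⟩
  + 1 * + (n C k)             ≡⟨ *-identityˡ (+ (n C k)) ⟩
  + (n C k)                   ∎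

pascal-suc-zero : ∀ z n → pascal z (suc n) 0 ≡ z * pascal z n 0
pascal-suc-zero z n = *-assoc z (z ^ n) (+ 1)

z^[n∸k]*nC[k+1]≡z*pascal : ∀ z n k → z ^ (n ∸ k) * + (n C suc k) ≡ z * pascal z n (suc k)
z^[n∸k]*nC[k+1]≡z*pascal z n k with k <? n
... | yes k<n rewrite ℕ.+-∸-assoc 1 k<n = *-assoc z (z ^ (n ∸ suc k)) (+ (n C suc k))
... | no  k≮n = begin
  z ^ (n ∸ k) * + (n C suc k) ≡⟨ cong (λ c → z ^ (n ∸ k) * + c) (k>n⇒nCk≡0 n<1+k) ⟩
  z ^ (n ∸ k) * + 0           ≡⟨ *-zeroʳ (z ^ (n ∸ k)) ⟩
  + 0                         ≡⟨ sym (*-zeroʳ z) ⟩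
  z * + 0                     ≡⟨ cong (z *_) (sym (k>n⇒pascal≡0 z n<1+k)) ⟩
  z * pascal z n (suc k)      ∎
  where
  n<1+k : n < suc k
  n<1+k = s≤s (ℕ.≮⇒≥ k≮n)

pascal-suc-suc : ∀ z n k → pascal z (suc n) (suc k) ≡ pascal z n k + z * pascal z n (suc k)
pascal-suc-suc z n k = begin
  z ^ (n ∸ k) * + (suc n C suc k)
    ≡⟨ cong (λ c → z ^ (n ∸ k) * + c) (sym (nCk+nC[k+1]≡[n+1]C[k+1] n k)) ⟩
  z ^ (n ∸ k) * (+ (n C k) + + (n C suc k))
    ≡⟨ *-distribˡ-+ (z ^ (n ∸ k)) (+ (n C k)) (+ (n C suc k)) ⟩
  pascal z n k + z ^ (n ∸ k) * + (n C suc k)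
    ≡⟨ cong (_+_ (pascal z n k)) (z^[n∸k]*nC[k+1]≡z*pascal z n k) ⟩
  pascal z n k + z * pascal z n (suc k) ∎

sumTo-pascal-suc-* : ∀ z N n (g : ℕ → ℤ) →
  sumTo (suc N) (λ l → pascal z (suc n) l * g l)
    ≡ z * sumTo (suc N) (λ l → pascal z n l * g l) + sumTo N (λ l → pascal z n l * g (suc l))
sumTo-pascal-suc-* z N n g = begin
  pascal z (suc n) 0 * g 0 + sumTo N (λ l → pascal z (suc n) (suc l) * g (suc l))
    ≡⟨ cong₂ _+_ (cong (_* g 0) (pascal-suc-zero z n)) (sumTo-cong N expand) ⟩
  z * p₀ * g 0 + sumTo N (λ l → u l + z * v l)
    ≡⟨ cong (_+_ (z * p₀ * g 0)) (sumTo-distrib-+ N u (λ l → z * v l)) ⟩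
  z * p₀ * g 0 + (sumTo N u + sumTo N (λ l → z * v l))
    ≡⟨ cong (λ s → z * p₀ * g 0 + (sumTo N u + s)) (sym (*-distribˡ-sumTo N z v)) ⟩
  z * p₀ * g 0 + (sumTo N u + z * sumTo N v)
    ≡⟨ regroup z p₀ (g 0) (sumTo N u) (sumTo N v) ⟩
  z * (p₀ * g 0 + sumTo N v) + sumTo N u ∎
  where
  p₀ = pascal z n 0
  u v : ℕ → ℤ
  u l = pascal z n l * g (suc l)
  v l = pascal z n (suc l) * g (suc l)
  distribʳ : ∀ p z q h → (p + z * q) * h ≡ p * h + z * (q * h)
  distribʳ = solve-∀
  expand : ∀ l → pascal z (suc n) (suc l) * g (suc l) ≡ u l + z * v l
  expand l = trans (cong (_* g (suc l)) (pascal-suc-suc z n l))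
                   (distribʳ (pascal z n l) z (pascal z n (suc l)) (g (suc l)))
  regroup : ∀ z p h A B → z * p * h + (A + z * B) ≡ z * (p * h + B) + A
  regroup = solve-∀

sumTo-*-pascal-suc-zero : ∀ z N (f : ℕ → ℤ) →
  sumTo N (λ l → f l * pascal z (suc l) 0) ≡ z * sumTo N (λ l → f l * pascal z l 0)
sumTo-*-pascal-suc-zero z N f = begin
  sumTo N (λ l → f l * pascal z (suc l) 0)
    ≡⟨ sumTo-cong N (λ l → trans (cong (f l *_) (pascal-suc-zero z l))
                                 (x[zy]≡z[xy] (f l) z (pascal z l 0))) ⟩
  sumTo N (λ l → z * (f l * pascal z l 0))
    ≡⟨ sym (*-distribˡ-sumTo N z (λ l → f l * pascal z l 0)) ⟩
  z * sumTo N (λ l → f l * pascal z l 0) ∎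
  where
  x[zy]≡z[xy] : ∀ x z y → x * (z * y) ≡ z * (x * y)
  x[zy]≡z[xy] = solve-∀

sumTo-*-pascal-suc-suc : ∀ z N (f : ℕ → ℤ) k →
  sumTo N (λ l → f l * pascal z (suc l) (suc k))
    ≡ sumTo N (λ l → f l * pascal z l k) + z * sumTo N (λ l → f l * pascal z l (suc k))
sumTo-*-pascal-suc-suc z N f k = begin
  sumTo N (λ l → f l * pascal z (suc l) (suc k))
    ≡⟨ sumTo-cong N expand ⟩
  sumTo N (λ l → u l + z * v l)
    ≡⟨ sumTo-distrib-+ N u (λ l → z * v l) ⟩
  sumTo N u + sumTo N (λ l → z * v l)
    ≡⟨ cong (_+_ (sumTo N u)) (sym (*-distribˡ-sumTo N z v)) ⟩
  sumTo N u + z * sumTo N v ∎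
  where
  u v : ℕ → ℤ
  u l = f l * pascal z l k
  v l = f l * pascal z l (suc k)
  distribˡ : ∀ h p z q → h * (p + z * q) ≡ h * p + z * (h * q)
  distribˡ = solve-∀
  expand : ∀ l → f l * pascal z (suc l) (suc k) ≡ u l + z * v l
  expand l = trans (cong (f l *_) (pascal-suc-suc z l k))
                   (distribˡ (f l) (pascal z l k) z (pascal z l (suc k)))

pascal-product : ∀ x y {N} n b → n < N →
  sumTo N (λ l → pascal x n l * pascal y l b) ≡ pascal (x + y) n b
pascal-product x y {suc N} zero zero    _ = cong (_+_ (+ 1)) (sumTo-0 N)
pascal-product x y {suc N} zero (suc b) _ = cong (_+_ (+ 0)) (sumTo-0 N)
pascal-product x y {suc N} (suc n) b (s≤s n<N) = begin
  sumTo (suc N) (λ l → pascal x (suc n) l * pascal y l b)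
    ≡⟨ sumTo-pascal-suc-* x N n (λ l → pascal y l b) ⟩
  x * S (suc N) b + T b
    ≡⟨ cong (λ s → x * s + T b) (pascal-product x y n b (ℕ.m<n⇒m<1+n n<N)) ⟩
  x * R b + T b
    ≡⟨ next-row b ⟩
  R′ b ∎
  where
  S : ℕ → ℕ → ℤ
  S N′ b′ = sumTo N′ (λ l → pascal x n l * pascal y l b′)
  T : ℕ → ℤ
  T b′ = sumTo N (λ l → pascal x n l * pascal y (suc l) b′)
  R R′ : ℕ → ℤ
  R  = pascal (x + y) n
  R′ = pascal (x + y) (suc n)
  next-row : ∀ b → x * R b + T b ≡ R′ b
  next-row zero = begin
    x * R 0 + T 0
      ≡⟨ cong (_+_ (x * R 0)) (sumTo-*-pascal-suc-zero y N (pascal x n)) ⟩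
    x * R 0 + y * S N 0
      ≡⟨ cong (λ s → x * R 0 + y * s) (pascal-product x y n 0 n<N) ⟩
    x * R 0 + y * R 0
      ≡⟨ sym (*-distribʳ-+ (R 0) x y) ⟩
    (x + y) * R 0
      ≡⟨ sym (pascal-suc-zero (x + y) n) ⟩
    R′ 0 ∎
  next-row (suc b) = begin
    x * R (suc b) + T (suc b)
      ≡⟨ cong (_+_ (x * R (suc b))) (sumTo-*-pascal-suc-suc y N (pascal x n) b) ⟩
    x * R (suc b) + (S N b + y * S N (suc b))
      ≡⟨ cong₂ (λ q s → x * R (suc b) + (q + y * s))
               (pascal-product x y n b n<N) (pascal-product x y n (suc b) n<N) ⟩
    x * R (suc b) + (R b + y * R (suc b))
      ≡⟨ regroup x y (R (suc b)) (R b) ⟩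
    R b + (x + y) * R (suc b)
      ≡⟨ sym (pascal-suc-suc (x + y) n b) ⟩
    R′ (suc b) ∎
    where
    regroup : ∀ x y r q → x * r + (q + y * r) ≡ q + (x + y) * r
    regroup = solve-∀

entryHF-pascal : ∀ m (i k : Fin (suc m)) → entryHF m i k ≡ pascal (+ 2) (toℕ i) (m ∸ toℕ k)
entryHF-pascal m i k = if-≤ᵇ-then-else-0 m (a ℕ.+ c)
  (λ _ → cong (λ e → (+ 2) ^ e * + (a C (m ∸ c))) (m+n∸o≡m∸[o∸n] a (toℕ≤pred[n] k)))
  (λ a+c<m → k>n⇒pascal≡0 (+ 2) (ℕ.m+n≤o⇒m≤o∸n (suc a) a+c<m))
  where
  a = toℕ i
  c = toℕ k

vartheta-pascal : ∀ m (i j : Fin (suc m)) → vartheta m i j ≡ pascal (- + 1) (m ∸ toℕ i) (m ∸ toℕ j)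
vartheta-pascal m i j = if-≤ᵇ-then-else-0 a c
  (λ a≤c → begin
    (- + 1) ^ (c ∸ a) * + ((m ∸ a) C (c ∸ a))
      ≡⟨ cong (λ e → (- + 1) ^ e * + ((m ∸ a) C e)) (sym ([m∸n]∸[m∸o]≡o∸n m a c≤m)) ⟩
    (- + 1) ^ ((m ∸ a) ∸ (m ∸ c)) * + ((m ∸ a) C ((m ∸ a) ∸ (m ∸ c)))
      ≡⟨ cong (λ t → (- + 1) ^ ((m ∸ a) ∸ (m ∸ c)) * + t) (sym (nCk≡nC[n∸k] (ℕ.∸-monoʳ-≤ m a≤c))) ⟩
    pascal (- + 1) (m ∸ a) (m ∸ c) ∎)
  (λ c<a → k>n⇒pascal≡0 (- + 1) (ℕ.∸-monoʳ-< c<a (toℕ≤pred[n] i)))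
  where
  a = toℕ i
  c = toℕ j
  c≤m = toℕ≤pred[n] j

entryFH-pascal : ∀ m (i k : Fin (suc m)) → entryFH m i k ≡ pascal (- + 2) (m ∸ toℕ i) (toℕ k)
entryFH-pascal m i k = if-≤ᵇ-then-else-0 (a ℕ.+ c) m
  (λ _ → cong (λ e → (- + 2) ^ e * + ((m ∸ a) C c)) (sym (ℕ.∸-+-assoc m a c)))
  (λ m<a+c → k>n⇒pascal≡0 (- + 2)
     (subst (m ∸ a <_) (ℕ.m+n∸m≡n a c) (ℕ.∸-monoˡ-< m<a+c (toℕ≤pred[n] i))))
  where
  a = toℕ i
  c = toℕ k

entryHF-isChangeOfBasis : ∀ m → IsChangeOfBasis m (vartheta m) (varphi m) (entryHF m)
entryHF-isChangeOfBasis m i j = begin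
  Σ (suc m) (λ k → entryHF m i k * vartheta m k j)
    ≡⟨ Σ-cong (suc m) (λ k → cong₂ _*_ (entryHF-pascal m i k) (vartheta-pascal m k j)) ⟩
  sumTo (suc m) (λ k → pascal (+ 2) a (m ∸ k) * pascal (- + 1) (m ∸ k) b)
    ≡⟨ sumTo-reverse m (λ l → pascal (+ 2) a l * pascal (- + 1) l b) ⟩
  sumTo (suc m) (λ l → pascal (+ 2) a l * pascal (- + 1) l b)
    ≡⟨ pascal-product (+ 2) (- + 1) a b (s≤s (toℕ≤pred[n] i)) ⟩
  pascal (+ 1) a b
    ≡⟨ pascal-1 a b ⟩
  varphi m i j ∎
  where
  a = toℕ i
  b = m ∸ toℕ j

entryFH-isChangeOfBasis : ∀ m → IsChangeOfBasis m (varphi m) (vartheta m) (entryFH m)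
entryFH-isChangeOfBasis m i j = begin
  Σ (suc m) (λ k → entryFH m i k * varphi m k j)
    ≡⟨ Σ-cong (suc m) (λ k → cong₂ _*_ (entryFH-pascal m i k) (sym (pascal-1 (toℕ k) b))) ⟩
  sumTo (suc m) (λ k → pascal (- + 2) n k * pascal (+ 1) k b)
    ≡⟨ pascal-product (- + 2) (+ 1) n b (s≤s (ℕ.m∸n≤m m (toℕ i))) ⟩
  pascal (- + 1) n b
    ≡⟨ sym (vartheta-pascal m i j) ⟩
  vartheta m i j ∎
  where
  n = m ∸ toℕ i
  b = m ∸ toℕ j

mainTheorem4 : (m : ℕ) → .{{_ : NonZero m}} →
    IsChangeOfBasis m (vartheta m) (varphi m) (entryHF m)
      × IsChangeOfBasis m (varphi m) (vartheta m) (entryFH m)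
mainTheorem4 m = entryHF-isChangeOfBasis m , entryFH-isChangeOfBasis m
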